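{- Let $n\ge 5$ and let $G$ be a graph with vertex set $\{x_1,\dots,x_n\}$ and edge set $\{x_jx_{j+1}: j=1,\dots,n-1\}\cup\{x_nx_1,\,x_1x_3,\,x_ix_{i+2}\}$ for some $i$ with $1<i\le n-2$. Then $W(G)<W(H_{n,2,2})$, with the unique exception of the case $n=6$, $i=4$ (the graph consisting of two disjoint triangles joined by two independent edges), for which $W(G)=W(H_{6,2,2})$.
   Context: All graphs are finite and simple. For a connected graph $G$, $d_G(u,v)$ is the distance between $u$ and $v$, and the Wiener index is $W(G)=\sum_{\{u,v\}\subseteq V(G)} d_G(u,v)$ (sum over unordered pairs of distinct vertices). $H_{n,2,2}$ is the graph on $n$ vertices consisting of three internally disjoint paths between the same two end-vertices, of lengths $2$, $2$ and $n-3$. -}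

module Defs where

open import Data.Nat using (ℕ; zero; suc; _+_; _∸_; _≡ᵇ_; _<ᵇ_)
open import Data.Bool using (Bool; true; false; _∧_; _∨_; if_then_else_)
open import Data.Fin using (Fin; toℕ)
open import Data.List using (List; []; _∷_; map; filter; allFin)
open import Data.Nat.ListAction using (sum)
open import Data.Bool.ListAction using (any)
import Data.Nat


-- A (simple) graph on the vertex set Fin n, given by its adjacency relation
-- (a symmetric, irreflexive Boolean-valued relation; the concrete graphs below are so).
Graph : ℕ → Set
Graph n = Fin n → Fin n → Bool

reach : ∀ {n} → Graph n → ℕ → Fin n → Fin n → Bool
reach G zero    u v = toℕ u ≡ᵇ toℕ v
reach G (suc k) u v =
  reach G k u v ∨ any (λ w → G u w ∧ reach G k w v) (allFin _)

-- least k ≤ bound with reach G k u v (returns bound if there is none).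
firstReach : ∀ {n} → Graph n → ℕ → ℕ → Fin n → Fin n → ℕ
firstReach G k zero      u v = k
firstReach G k (suc fuel) u v =
  if reach G k u v then k else firstReach G (suc k) fuel u v

-- Distance d_G(u,v): length of a shortest u–v walk (= shortest path).
-- In a connected graph on n vertices it is at most n - 1, so searching
-- k = 0,1,…,n suffices.
dist : ∀ {n} → Graph n → Fin n → Fin n → ℕ
dist {n} G u v = firstReach G 0 n u v

W : ∀ {n} → Graph n → ℕ
W {n} G = sum (map (λ u → sum (map (λ v → dist G u v)
                     (filter (λ v → Data.Nat._<?_ (toℕ u) (toℕ v)) (allFin n))))
                   (allFin n))

symm : (ℕ → ℕ → Bool) → (ℕ → ℕ → Bool)
symm E p q = E p q ∨ E q p

-- The graph G of the statement, with x_{j} ↦ vertex j - 1 (0-indexed):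
-- edges x_j x_{j+1} (1 ≤ j ≤ n-1), x_n x_1, x_1 x_3, x_i x_{i+2}.
Gedge : ℕ → ℕ → ℕ → ℕ → Bool
Gedge n i p q =
     (suc p ≡ᵇ q)                         -- x_{p+1} x_{p+2}, p+1 < n since q < n
  ∨ ((p ≡ᵇ (n ∸ 1)) ∧ (q ≡ᵇ 0))
  ∨ ((p ≡ᵇ 0) ∧ (q ≡ᵇ 2))
  ∨ ((p ≡ᵇ (i ∸ 1)) ∧ (q ≡ᵇ (i + 1)))

Gni : (n i : ℕ) → Graph n
Gni n i u v = symm (Gedge n i) (toℕ u) (toℕ v)

-- H_{n,2,2}: end-vertices a = 0, b = 1; paths a-2-b, a-3-b (length 2 each) and
-- a-4-5-…-(n-1)-b (length n-3, for n ≥ 5).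
Hedge : ℕ → ℕ → ℕ → Bool
Hedge n p q =
     ((p ≡ᵇ 0) ∧ (q ≡ᵇ 2)) ∨ ((p ≡ᵇ 2) ∧ (q ≡ᵇ 1))
  ∨ ((p ≡ᵇ 0) ∧ (q ≡ᵇ 3)) ∨ ((p ≡ᵇ 3) ∧ (q ≡ᵇ 1))
  ∨ ((p ≡ᵇ 0) ∧ (q ≡ᵇ 4))
  ∨ ((3 <ᵇ p) ∧ (suc p ≡ᵇ q))
  ∨ ((p ≡ᵇ (n ∸ 1)) ∧ (q ≡ᵇ 1))

H22 : (n : ℕ) → Graph n
H22 n u v = symm (Hedge n) (toℕ u) (toℕ v)

module Submission where

-- Write n = 5 + N and work with 2W = Σ_{u,v} d(u,v). In G the vertices x₂ and x_{i+1} are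
-- bypassed by the chords x₁x₃ and x_ix_{i+2}: deleting either one leaves an (n−1)-cycle, and
-- for i ≥ 3 deleting both leaves an (n−2)-cycle. Distances in G are at most the distances
-- along these cycles, and removing the bypassed vertices from the double sum one at a time
-- (each removal contributes twice the row of the removed vertex) gives
--   2W(G) ≤ (n+1)σ(n−1) + 2                for i = 2,
--   2W(G) ≤ (n−2)σ(n−2) + 4σ(n−1) + n     for i ≥ 3,
-- where σ(m) = ⌊m²/4⌋ is the transmission of a vertex of C_m. In H_{n,2,2} the middle vertices
-- of the two short paths are twins on an (n−1)-cycle; the cyclic distance is 1-Lipschitz along
-- the edges of H, hence a lower bound for d_H, and the twins are at distance 2, so
-- 2W(H) ≥ (n+1)σ(n−1) + 4. Evaluating σ according to the parity of n shows that these bounds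
-- separate W(G) from W(H) except when n = 6, where the remaining cases are computed.

open import Defs
open import Data.Nat using (ℕ; _≤_; _<_; _∸_; zero; suc; _+_; _*_; _⊓_; z≤n; s≤s; z<s; s<s; ∣_-_∣; _≡ᵇ_; _<ᵇ_; _<?_; NonZero)
open import Data.Product using (_×_; Σ; _,_; proj₁; proj₂)
open import Relation.Nullary using (¬_; does)
open import Relation.Binary.PropositionalEquality using (_≡_; _≢_; refl; sym; trans; cong; cong₂; subst; subst₂; module ≡-Reasoning)

open import Data.Bool using (Bool; true; false; _∧_; _∨_; T; if_then_else_)
open import Data.Bool.Properties using (T-∨; T-∧; ∨-comm)
open import Data.Empty using (⊥-elim)
open import Data.Fin using (Fin; toℕ)
open import Data.Fin.Properties using (toℕ-injective; toℕ-fromℕ<; toℕ<n)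
open import Data.List using ([]; _∷_; map; filter; allFin; tabulate)
open import Data.List.Membership.Propositional using (lose)
open import Data.List.Membership.Propositional.Properties using (∈-allFin)
open import Data.List.Properties using (map-tabulate; map-cong)
open import Data.List.Relation.Unary.Any using (satisfied)
open import Data.List.Relation.Unary.Any.Properties using (any⁺; any⁻)
open import Data.Nat.DivMod using (_mod_; m<n⇒m%n≡m)
open import Data.Nat.ListAction using (sum)
open import Data.Nat.Properties
open import Algebra.Properties.CommutativeSemigroup +-commutativeSemigroup using (x∙yz≈y∙xz; interchange)
open import Data.Nat.Tactic.RingSolver using (solve-∀)
open import Data.Sum using (_⊎_; inj₁; inj₂; [_,_]; swap)
open import Data.Unit using (tt)
open import Function using (_∘_; Equivalence)
open import Relation.Unary using (Decidable)

-- Walks and distances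

Undirected : ∀ {n} → Graph n → Set
Undirected G = ∀ u v → G u v ≡ G v u

symm-undirected : ∀ {n} (E : ℕ → ℕ → Bool) → Undirected {n} (λ u v → symm E (toℕ u) (toℕ v))
symm-undirected E u v = ∨-comm (E (toℕ u) (toℕ v)) (E (toℕ v) (toℕ u))

∨-introˡ : ∀ {x} y → T x → T (x ∨ y)
∨-introˡ {true} y _ = _

∨-introʳ : ∀ x {y} → T y → T (x ∨ y)
∨-introʳ true  _  = _
∨-introʳ false ty = ty

module Walks {n} (G : Graph n) where

  -- A record rather than T (reach G k u v) itself, so that k, u and v can be inferred.
  record Reaches (k : ℕ) (u v : Fin n) : Set where
    constructor reaches
    field walk : T (reach G k u v)
  open Reaches

  reach-refl : ∀ k u → Reaches k u u
  reach-refl zero    u = reaches (≡⇒≡ᵇ (toℕ u) (toℕ u) refl)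
  reach-refl (suc k) u = reaches (∨-introˡ _ (walk (reach-refl k u)))

  reach-zero : ∀ {u v} → Reaches 0 u v → u ≡ v
  reach-zero {u} {v} r = toℕ-injective (≡ᵇ⇒≡ (toℕ u) (toℕ v) (walk r))

  reach-suc : ∀ {k u v} → Reaches k u v → Reaches (suc k) u v
  reach-suc r = reaches (∨-introˡ _ (walk r))

  reach-step : ∀ {k u w v} → T (G u w) → Reaches k w v → Reaches (suc k) u v
  reach-step {k} {u} {w} {v} e r = reaches
    (∨-introʳ (reach G k u v) (any⁺ _ (lose (∈-allFin w) (Equivalence.from T-∧ (e , walk r)))))

  reach-unstep : ∀ {k u v} → Reaches (suc k) u v →
                 Reaches k u v ⊎ Σ (Fin n) (λ w → T (G u w) × Reaches k w v)
  reach-unstep {k} {u} {v} r with Equivalence.to T-∨ (walk r)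
  ... | inj₁ r′ = inj₁ (reaches r′)
  ... | inj₂ a with satisfied (any⁻ _ (allFin n) a)
  ...   | w , p = inj₂ (w , proj₁ (Equivalence.to T-∧ p) , reaches (proj₂ (Equivalence.to T-∧ p)))

  reach-trans : ∀ {k l u w v} → Reaches k u w → Reaches l w v → Reaches (k + l) u v
  reach-trans {zero} r s with refl ← reach-zero r = s
  reach-trans {suc k} r s with reach-unstep r
  ... | inj₁ r′           = reach-suc (reach-trans r′ s)
  ... | inj₂ (w , e , r′) = reach-step e (reach-trans r′ s)

  reach-mono : ∀ {k l u v} → k ≤ l → Reaches k u v → Reaches l u v
  reach-mono k≤l r with m≤n⇒∃[o]m+o≡n k≤l
  ... | d , refl = reach-trans r (reach-refl d _)

  reach-sym : Undirected G → ∀ {k u v} → Reaches k u v → Reaches k v u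
  reach-sym G-sym {zero} r with refl ← reach-zero r = r
  reach-sym G-sym {suc k} {u} {v} r with reach-unstep r
  ... | inj₁ r′           = reach-suc (reach-sym G-sym r′)
  ... | inj₂ (w , e , r′) = subst (λ l → Reaches l v u) (+-comm k 1)
    (reach-trans (reach-sym G-sym r′) (reach-step (subst T (G-sym u w) e) (reach-refl 0 u)))

  reach-one : ∀ {u v} → Reaches 1 u v → u ≡ v ⊎ T (G u v)
  reach-one r with reach-unstep r
  ... | inj₁ r′ = inj₁ (reach-zero r′)
  ... | inj₂ (w , e , r′) with refl ← reach-zero r′ = inj₂ e

  firstReach-≤ : ∀ fuel {s k u v} → s ≤ k → k ≤ s + fuel → Reaches k u v →
                 firstReach G s fuel u v ≤ k
  firstReach-≤ zero       s≤k _  _ = s≤k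
  firstReach-≤ (suc fuel) {s} {k} {u} {v} s≤k k≤ r with reach G s u v in eq
  ... | true  = s≤k
  ... | false with m≤n⇒m<n∨m≡n s≤k
  ...   | inj₁ s<k  = firstReach-≤ fuel s<k (subst (k ≤_) (+-suc s fuel) k≤) r
  ...   | inj₂ refl = ⊥-elim (subst T eq (walk r))

  firstReach-bounded : ∀ fuel s u v → firstReach G s fuel u v ≤ s + fuel
  firstReach-bounded zero       s u v = m≤m+n s 0
  firstReach-bounded (suc fuel) s u v with reach G s u v
  ... | true  = m≤m+n s (suc fuel)
  ... | false = subst (firstReach G (suc s) fuel u v ≤_) (sym (+-suc s fuel))
                  (firstReach-bounded fuel (suc s) u v)

  firstReach-reaches : ∀ fuel s u v →
    Reaches (firstReach G s fuel u v) u v ⊎ firstReach G s fuel u v ≡ s + fuel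
  firstReach-reaches zero       s u v = inj₂ (sym (+-identityʳ s))
  firstReach-reaches (suc fuel) s u v with reach G s u v in eq
  ... | true  = inj₁ (reaches (subst T (sym eq) _))
  ... | false with firstReach-reaches fuel (suc s) u v
  ...   | inj₁ r = inj₁ r
  ...   | inj₂ e = inj₂ (trans e (sym (+-suc s fuel)))

  dist-≤ : ∀ {k u v} → Reaches k u v → k ≤ n → dist G u v ≤ k
  dist-≤ r k≤n = firstReach-≤ n z≤n k≤n r

  dist≤n : ∀ u v → dist G u v ≤ n
  dist≤n = firstReach-bounded n 0

  dist-self : ∀ u → dist G u u ≡ 0
  dist-self u = n≤0⇒n≡0 (dist-≤ (reach-refl 0 u) z≤n)

  dist-reaches : ∀ u v → Reaches (dist G u v) u v ⊎ dist G u v ≡ n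
  dist-reaches = firstReach-reaches n 0

  dist-sym : Undirected G → ∀ u v → dist G u v ≡ dist G v u
  dist-sym G-sym u v = ≤-antisym (dist-≤-swap u v) (dist-≤-swap v u)
    where
    dist-≤-swap : ∀ u v → dist G u v ≤ dist G v u
    dist-≤-swap u v with dist-reaches v u
    ... | inj₁ r = dist-≤ (reach-sym G-sym r) (dist≤n v u)
    ... | inj₂ e = subst (dist G u v ≤_) (sym e) (dist≤n u v)

  dist-> : ∀ {k u v} → k < n → ¬ Reaches k u v → k < dist G u v
  dist-> {k} {u} {v} k<n ¬r with dist-reaches u v
  ... | inj₁ r = ≰⇒> (λ d≤k → ¬r (reach-mono d≤k r))
  ... | inj₂ e = subst (k <_) (sym e) k<n

  module _ (f : Fin n → ℕ) (f-edge : ∀ x w → T (G x w) → f x ≤ suc (f w)) where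

    walk-lipschitz : ∀ {k x v} → Reaches k x v → f x ≤ k + f v
    walk-lipschitz {zero} r with refl ← reach-zero r = ≤-refl
    walk-lipschitz {suc k} {x} r with reach-unstep r
    ... | inj₁ r′           = m≤n⇒m≤1+n (walk-lipschitz r′)
    ... | inj₂ (w , e , r′) = ≤-trans (f-edge x w e) (s≤s (walk-lipschitz r′))

    dist-lipschitz : ∀ {u v} → f u ≤ n + f v → f u ≤ dist G u v + f v
    dist-lipschitz {u} {v} f≤ with dist-reaches u v
    ... | inj₁ r = walk-lipschitz r
    ... | inj₂ e rewrite e = f≤

-- Finite sums

∑ : ℕ → (ℕ → ℕ) → ℕ
∑ zero    f = 0
∑ (suc n) f = f 0 + ∑ n (λ j → f (suc j))

syntax ∑ n (λ j → e) = ∑[ j < n ] e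

∑∑ : ℕ → (ℕ → ℕ → ℕ) → ℕ
∑∑ n f = ∑[ a < n ] ∑[ b < n ] f a b

∑-cong : ∀ n {f g : ℕ → ℕ} → (∀ j → j < n → f j ≡ g j) → ∑ n f ≡ ∑ n g
∑-cong zero    eq = refl
∑-cong (suc n) eq = cong₂ _+_ (eq 0 z<s) (∑-cong n (λ j j<n → eq (suc j) (s<s j<n)))

∑-mono-≤ : ∀ n {f g : ℕ → ℕ} → (∀ j → j < n → f j ≤ g j) → ∑ n f ≤ ∑ n g
∑-mono-≤ zero    le = z≤n
∑-mono-≤ (suc n) le = +-mono-≤ (le 0 z<s) (∑-mono-≤ n (λ j j<n → le (suc j) (s<s j<n)))

∑-distrib-+ : ∀ n (f g : ℕ → ℕ) → ∑[ j < n ] (f j + g j) ≡ ∑ n f + ∑ n g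
∑-distrib-+ zero    f g = refl
∑-distrib-+ (suc n) f g =
  trans (cong (f 0 + g 0 +_) (∑-distrib-+ n (λ j → f (suc j)) (λ j → g (suc j))))
        (interchange (f 0) (g 0) _ _)

∑-const : ∀ n c → ∑[ j < n ] c ≡ n * c
∑-const zero    c = refl
∑-const (suc n) c = cong (c +_) (∑-const n c)

∑-init-last : ∀ n (f : ℕ → ℕ) → ∑ (suc n) f ≡ ∑ n f + f n
∑-init-last zero    f = +-comm (f 0) 0
∑-init-last (suc n) f = trans (cong (f 0 +_) (∑-init-last n (λ j → f (suc j))))
                              (sym (+-assoc (f 0) _ _))

∑∑-upper : ∀ n (f : ℕ → ℕ → ℕ) → (∀ a b → f a b ≡ f b a) → (∀ a → f a a ≡ 0) →
  2 * ∑[ a < n ] ∑[ b < n ] (if a <ᵇ b then f a b else 0) ≡ ∑∑ n f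
∑∑-upper zero    f f-sym f-diag = refl
∑∑-upper (suc n) f f-sym f-diag = begin
  2 * (first-row + ∑[ a < n ] ∑[ b < n ] (if a <ᵇ b then f′ a b else 0))
    ≡⟨ double first-row _ ⟩
  first-row + (first-row + 2 * ∑[ a < n ] ∑[ b < n ] (if a <ᵇ b then f′ a b else 0))
    ≡⟨ cong (λ x → first-row + (first-row + x))
            (∑∑-upper n f′ (λ a b → f-sym (suc a) (suc b)) (f-diag ∘ suc)) ⟩
  first-row + (first-row + ∑∑ n f′)
    ≡⟨ cong₂ (λ x y → x + first-row + (y + ∑∑ n f′)) (f-diag 0) first-column≡first-row ⟨
  f 0 0 + first-row + (∑[ a < n ] f (suc a) 0 + ∑∑ n f′)
    ≡⟨ cong (f 0 0 + first-row +_) (∑-distrib-+ n (λ a → f (suc a) 0) _) ⟨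
  ∑∑ (suc n) f ∎
  where
  open ≡-Reasoning
  f′ : ℕ → ℕ → ℕ
  f′ a b = f (suc a) (suc b)
  first-row : ℕ
  first-row = ∑[ b < n ] f 0 (suc b)
  first-column≡first-row : ∑[ a < n ] f (suc a) 0 ≡ first-row
  first-column≡first-row = ∑-cong n (λ a _ → f-sym (suc a) 0)
  double : ∀ r u → 2 * (r + u) ≡ r + (r + 2 * u)
  double = solve-∀

punchIn : ℕ → ℕ → ℕ
punchIn zero    j       = suc j
punchIn (suc p) zero    = zero
punchIn (suc p) (suc j) = suc (punchIn p j)

punchIn-≤ : ∀ p j → punchIn p j ≤ suc j
punchIn-≤ zero    j       = ≤-refl
punchIn-≤ (suc p) zero    = z≤n
punchIn-≤ (suc p) (suc j) = s≤s (punchIn-≤ p j)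

punchIn-≥ : ∀ {p j} → p ≤ j → punchIn p j ≡ suc j
punchIn-≥ {zero}            _         = refl
punchIn-≥ {suc p} {suc j} (s≤s p≤j) = cong suc (punchIn-≥ p≤j)

punchIn-step : ∀ q t → punchIn (suc q) (suc t) ≡ suc (punchIn (suc q) t)
                     ⊎ (punchIn (suc q) t ≡ q × punchIn (suc q) (suc t) ≡ suc (suc q))
punchIn-step zero    zero    = inj₂ (refl , refl)
punchIn-step zero    (suc t) = inj₁ refl
punchIn-step (suc q) zero    = inj₁ refl
punchIn-step (suc q) (suc t) with punchIn-step q t
... | inj₁ eq          = inj₁ (cong suc eq)
... | inj₂ (eq₁ , eq₂) = inj₂ (cong suc eq₁ , cong suc eq₂)

∑-punchIn : ∀ {n} p (f : ℕ → ℕ) → p ≤ n → ∑ (suc n) f ≡ f p + ∑[ j < n ] f (punchIn p j)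
∑-punchIn zero    f _ = refl
∑-punchIn {suc n} (suc p) f (s≤s p≤n) =
  trans (cong (f 0 +_) (∑-punchIn p (λ j → f (suc j)) p≤n))
        (x∙yz≈y∙xz (f 0) (f (suc p)) (∑[ j < n ] f (suc (punchIn p j))))

∑∑-punchIn : ∀ {n} p (f : ℕ → ℕ → ℕ) → p ≤ n → (∀ a → f a p ≡ f p a) → f p p ≡ 0 →
  ∑∑ (suc n) f ≡ ∑∑ n (λ a b → f (punchIn p a) (punchIn p b)) + 2 * ∑[ b < suc n ] f p b
∑∑-punchIn {n} p f p≤n f-sym f-pp = begin
  ∑∑ (suc n) f
    ≡⟨ ∑-punchIn p row p≤n ⟩
  row p + ∑[ a < n ] row (punchIn p a)
    ≡⟨ cong (row p +_) (∑-cong n (λ a _ → ∑-punchIn p (f (punchIn p a)) p≤n)) ⟩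
  row p + ∑[ a < n ] (f (punchIn p a) p + ∑[ b < n ] f (punchIn p a) (punchIn p b))
    ≡⟨ cong (row p +_) (∑-distrib-+ n (λ a → f (punchIn p a) p) _) ⟩
  row p + (∑[ a < n ] f (punchIn p a) p + ∑∑ n f′)
    ≡⟨ cong (λ c → row p + (c + ∑∑ n f′)) column≡row ⟩
  row p + (row p + ∑∑ n f′)
    ≡⟨ double (row p) (∑∑ n f′) ⟩
  ∑∑ n f′ + 2 * row p ∎
  where
  open ≡-Reasoning
  row : ℕ → ℕ
  row a = ∑[ b < suc n ] f a b
  f′ : ℕ → ℕ → ℕ
  f′ a b = f (punchIn p a) (punchIn p b)
  column≡row : ∑[ a < n ] f (punchIn p a) p ≡ row p
  column≡row = trans (∑-cong n (λ a _ → f-sym (punchIn p a)))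
                     (sym (trans (∑-punchIn p (f p) p≤n) (cong (_+ ∑[ a < n ] f p (punchIn p a)) f-pp)))
  double : ∀ x y → x + (x + y) ≡ y + 2 * x
  double = solve-∀

-- The Wiener index as a double sum

sum-tabulate : ∀ n (k : ℕ → ℕ) → sum (tabulate {n = n} (k ∘ toℕ)) ≡ ∑ n k
sum-tabulate zero    k = refl
sum-tabulate (suc n) k = cong (k 0 +_) (sum-tabulate n (k ∘ suc))

sum-map-filter : ∀ {A : Set} {P : A → Set} (P? : Decidable P) (f : A → ℕ) xs →
  sum (map f (filter P? xs)) ≡ sum (map (λ x → if does (P? x) then f x else 0) xs)
sum-map-filter P? f []       = refl
sum-map-filter P? f (x ∷ xs) with does (P? x)
... | true  = cong (f x +_) (sum-map-filter P? f xs)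
... | false = sum-map-filter P? f xs

module _ {n} .{{_ : NonZero n}} where

  -- Distance between vertex labels; the labels used are always below n.
  δ : Graph n → ℕ → ℕ → ℕ
  δ G a b = dist G (a mod n) (b mod n)

  δ-sym : ∀ {G} → Undirected G → ∀ a b → δ G a b ≡ δ G b a
  δ-sym {G} G-sym a b = Walks.dist-sym G G-sym (a mod n) (b mod n)

  δ-self : ∀ G a → δ G a a ≡ 0
  δ-self G a = Walks.dist-self G (a mod n)

  toℕ-mod : ∀ {a} → a < n → toℕ (a mod n) ≡ a
  toℕ-mod a<n = trans (toℕ-fromℕ< _) (m<n⇒m%n≡m a<n)

  sum-allFin : (f : Fin n → ℕ) → sum (map f (allFin n)) ≡ ∑[ a < n ] f (a mod n)
  sum-allFin f = begin
    sum (map f (allFin n))                        ≡⟨ cong sum (map-cong mod-toℕ (allFin n)) ⟨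
    sum (map (λ u → f (toℕ u mod n)) (allFin n))
      ≡⟨ cong sum (map-tabulate {n = n} (λ u → u) (λ u → f (toℕ u mod n))) ⟩
    sum (tabulate {n = n} (λ u → f (toℕ u mod n))) ≡⟨ sum-tabulate n (λ a → f (a mod n)) ⟩
    ∑[ a < n ] f (a mod n)                        ∎
    where
    open ≡-Reasoning
    mod-toℕ : ∀ u → f (toℕ u mod n) ≡ f u
    mod-toℕ u = cong f (toℕ-injective (toℕ-mod (toℕ<n u)))

  W-as-∑∑ : (G : Graph n) → Undirected G → 2 * W G ≡ ∑∑ n (δ G)
  W-as-∑∑ G G-sym = begin
    2 * W G
      ≡⟨ cong (2 *_) (trans (cong sum (map-cong inner (allFin n))) (sum-allFin _)) ⟩
    2 * ∑[ a < n ] ∑[ b < n ] (if toℕ (a mod n) <ᵇ b then δ G a b else 0)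
      ≡⟨ cong (2 *_) (∑-cong n (λ a a<n → cong (λ x → ∑[ b < n ] (if x <ᵇ b then δ G a b else 0))
                                                  (toℕ-mod a<n))) ⟩
    2 * ∑[ a < n ] ∑[ b < n ] (if a <ᵇ b then δ G a b else 0)
      ≡⟨ ∑∑-upper n (δ G) (δ-sym G-sym) (δ-self G) ⟩
    ∑∑ n (δ G) ∎
    where
    open ≡-Reasoning
    inner : ∀ u → sum (map (dist G u) (filter (λ v → toℕ u <? toℕ v) (allFin n)))
                ≡ ∑[ b < n ] (if toℕ u <ᵇ b then dist G u (b mod n) else 0)
    inner u = begin
      sum (map (dist G u) (filter (λ v → toℕ u <? toℕ v) (allFin n)))
        ≡⟨ sum-map-filter (λ v → toℕ u <? toℕ v) (dist G u) (allFin n) ⟩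
      sum (map (λ v → if toℕ u <ᵇ toℕ v then dist G u v else 0) (allFin n))
        ≡⟨ sum-allFin _ ⟩
      ∑[ b < n ] (if toℕ u <ᵇ toℕ (b mod n) then dist G u (b mod n) else 0)
        ≡⟨ ∑-cong n (λ b b<n → cong (λ x → if toℕ u <ᵇ x then dist G u (b mod n) else 0)
                                    (toℕ-mod b<n)) ⟩
      ∑[ b < n ] (if toℕ u <ᵇ b then dist G u (b mod n) else 0) ∎

-- Distances on a cycle

cycLen : ℕ → ℕ → ℕ
cycLen m x = x ⊓ (m ∸ x)

cycDist : ℕ → ℕ → ℕ → ℕ
cycDist m a b = cycLen m ∣ a - b ∣

-- The transmission of a vertex of the cycle C_m, which equals ⌊m²/4⌋.
cycleStatus : ℕ → ℕ
cycleStatus m = ∑[ l < m ] cycDist m 0 l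

cycDist-comm : ∀ m a b → cycDist m a b ≡ cycDist m b a
cycDist-comm m a b = cong (cycLen m) (∣-∣-comm a b)

cycDist-self : ∀ m a → cycDist m a a ≡ 0
cycDist-self m a = cong (cycLen m) (∣n-n∣≡0 a)

cycDist≤ : ∀ m a b → cycDist m a b ≤ m
cycDist≤ m a b = ≤-trans (m⊓n≤n _ _) (m∸n≤m m ∣ a - b ∣)

∣-∣≤ : ∀ {m a b} → a ≤ m → b ≤ m → ∣ a - b ∣ ≤ m
∣-∣≤ {m} {a} {b} a≤m b≤m = ≤-trans (∣m-n∣≤m⊔n a b) (⊔-lub a≤m b≤m)

2*cycDist≤ : ∀ {m a b} → a ≤ m → b ≤ m → 2 * cycDist m a b ≤ m
2*cycDist≤ {m} {a} {b} a≤m b≤m = begin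
  2 * cycLen m x                   ≡⟨ cong (cycLen m x +_) (+-identityʳ _) ⟩
  cycLen m x + cycLen m x          ≤⟨ +-mono-≤ (m⊓n≤m x (m ∸ x)) (m⊓n≤n x (m ∸ x)) ⟩
  x + (m ∸ x)                      ≡⟨ m+[n∸m]≡n (∣-∣≤ a≤m b≤m) ⟩
  m                                ∎
  where
  open ≤-Reasoning
  x = ∣ a - b ∣

cycLen-complement : ∀ {m x} → x ≤ m → cycLen m (m ∸ x) ≡ cycLen m x
cycLen-complement {m} {x} x≤m = trans (cong ((m ∸ x) ⊓_) (m∸[m∸n]≡n x≤m)) (⊓-comm (m ∸ x) x)

cycDist-row : ∀ {m} c → c < m → ∑[ l < m ] cycDist m c l ≡ cycleStatus m
cycDist-row           zero    _         = refl
cycDist-row {suc m} (suc c) (s<s c<m) = begin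
  cycDist (suc m) (suc c) 0 + ∑[ l < m ] cycDist (suc m) c l
    ≡⟨ +-comm (cycDist (suc m) (suc c) 0) _ ⟩
  ∑[ l < m ] cycDist (suc m) c l + cycDist (suc m) (suc c) 0
    ≡⟨ cong (∑[ l < m ] cycDist (suc m) c l +_) wrap-around ⟩
  ∑[ l < m ] cycDist (suc m) c l + cycDist (suc m) c m
    ≡⟨ ∑-init-last m (cycDist (suc m) c) ⟨
  ∑[ l < suc m ] cycDist (suc m) c l
    ≡⟨ cycDist-row c (m<n⇒m<1+n c<m) ⟩
  cycleStatus (suc m) ∎
  where
  open ≡-Reasoning
  wrap-around : cycDist (suc m) (suc c) 0 ≡ cycDist (suc m) c m
  wrap-around = trans (sym (cycLen-complement {suc m} (<⇒≤ (s<s c<m))))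
                      (cong (cycLen (suc m)) (sym (m≤n⇒∣m-n∣≡n∸m (<⇒≤ c<m))))

cycleStatus-suc-suc : ∀ m → cycleStatus (suc (suc m)) ≡ suc m + cycleStatus m
cycleStatus-suc-suc m = begin
  ∑[ l < suc m ] (suc l ⊓ (suc m ∸ l))
    ≡⟨ ∑-cong (suc m) (λ l l<sm → cong (suc l ⊓_) (+-∸-assoc 1 (≤-pred l<sm))) ⟩
  ∑[ l < suc m ] (1 + cycLen m l)
    ≡⟨ ∑-distrib-+ (suc m) (λ _ → 1) (cycLen m) ⟩
  ∑[ l < suc m ] 1 + ∑[ l < suc m ] cycLen m l
    ≡⟨ cong₂ _+_ (trans (∑-const (suc m) 1) (*-identityʳ (suc m))) (∑-init-last m (cycLen m)) ⟩
  suc m + (cycleStatus m + m ⊓ (m ∸ m))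
    ≡⟨ cong (λ z → suc m + (cycleStatus m + z)) (trans (cong (m ⊓_) (n∸n≡0 m)) (⊓-zeroʳ m)) ⟩
  suc m + (cycleStatus m + 0)
    ≡⟨ cong (suc m +_) (+-identityʳ (cycleStatus m)) ⟩
  suc m + cycleStatus m ∎
  where open ≡-Reasoning

cycleStatus-even : ∀ r → cycleStatus (r + r) ≡ r * r
cycleStatus-even zero    = refl
cycleStatus-even (suc r) = begin
  cycleStatus (suc r + suc r)        ≡⟨ cong (cycleStatus ∘ suc) (+-suc r r) ⟩
  cycleStatus (suc (suc (r + r)))    ≡⟨ cycleStatus-suc-suc (r + r) ⟩
  suc (r + r) + cycleStatus (r + r)  ≡⟨ cong (suc (r + r) +_) (cycleStatus-even r) ⟩
  suc (r + r) + r * r                ≡⟨ square r ⟩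
  suc r * suc r                      ∎
  where
  open ≡-Reasoning
  square : ∀ r → suc (r + r) + r * r ≡ suc r * suc r
  square = solve-∀

cycleStatus-odd : ∀ r → cycleStatus (suc (r + r)) ≡ r * r + r
cycleStatus-odd zero    = refl
cycleStatus-odd (suc r) = begin
  cycleStatus (suc (suc r + suc r))          ≡⟨ cong (cycleStatus ∘ suc ∘ suc) (+-suc r r) ⟩
  cycleStatus (suc (suc (suc (r + r))))      ≡⟨ cycleStatus-suc-suc (suc (r + r)) ⟩
  suc (suc (r + r)) + cycleStatus (suc (r + r))
    ≡⟨ cong (suc (suc (r + r)) +_) (cycleStatus-odd r) ⟩
  suc (suc (r + r)) + (r * r + r)            ≡⟨ oblong r ⟩
  suc r * suc r + suc r                      ∎
  where
  open ≡-Reasoning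
  oblong : ∀ r → suc (suc (r + r)) + (r * r + r) ≡ suc r * suc r + suc r
  oblong = solve-∀

cycLen-lipschitz : ∀ {m x y} → x ≤ suc y → y ≤ suc x → y ≤ m → cycLen m x ≤ suc (cycLen m y)
cycLen-lipschitz {m} {x} {y} x≤1+y y≤1+x y≤m = ⊓-mono-≤ x≤1+y (begin
  suc m ∸ suc x  ≤⟨ ∸-monoʳ-≤ (suc m) y≤1+x ⟩
  suc m ∸ y      ≡⟨ +-∸-assoc 1 y≤m ⟩
  suc (m ∸ y)    ∎)
  where open ≤-Reasoning

data CycleAdjacent (m : ℕ) : ℕ → ℕ → Set where
  next : ∀ {a} → suc a < m → CycleAdjacent m a (suc a)
  wrap : CycleAdjacent m (m ∸ 1) 0

∣n-1+n∣≡1 : ∀ a → ∣ a - suc a ∣ ≡ 1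
∣n-1+n∣≡1 zero    = refl
∣n-1+n∣≡1 (suc a) = ∣n-1+n∣≡1 a

cycDist-adjacent : ∀ {m a b c} → CycleAdjacent m a b → c < m →
  cycDist m a c ≤ suc (cycDist m b c) × cycDist m b c ≤ suc (cycDist m a c)
cycDist-adjacent {m} {a} {c = c} (next a+1<m) c<m =
  cycLen-lipschitz x≤1+y y≤1+x (∣-∣≤ (<⇒≤ a+1<m) (<⇒≤ c<m)) ,
  cycLen-lipschitz y≤1+x x≤1+y (∣-∣≤ (<⇒≤ (<-trans (n<1+n a) a+1<m)) (<⇒≤ c<m))
  where
  x≤1+y : ∣ a - c ∣ ≤ suc ∣ suc a - c ∣
  x≤1+y = subst (λ d → ∣ a - c ∣ ≤ d + ∣ suc a - c ∣) (∣n-1+n∣≡1 a) (∣-∣-triangle a (suc a) c)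
  y≤1+x : ∣ suc a - c ∣ ≤ suc ∣ a - c ∣
  y≤1+x = subst (λ d → ∣ suc a - c ∣ ≤ d + ∣ a - c ∣)
                (trans (∣-∣-comm (suc a) a) (∣n-1+n∣≡1 a)) (∣-∣-triangle (suc a) a c)
cycDist-adjacent {suc m} {c = c} wrap (s≤s c≤m) =
  subst (λ d → d ≤ suc (cycLen (suc m) c) × cycLen (suc m) c ≤ suc d) (sym last≡complement)
    (cycLen-lipschitz ≤-refl c≤2+c (m≤n⇒m≤1+n c≤m) , cycLen-lipschitz c≤2+c ≤-refl (s≤s c≤m))
  where
  open ≡-Reasoning
  c≤2+c : c ≤ suc (suc c)
  c≤2+c = m≤n⇒m≤1+n (n≤1+n c)
  last≡complement : cycDist (suc m) m c ≡ cycLen (suc m) (suc c)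
  last≡complement = begin
    cycLen (suc m) ∣ m - c ∣       ≡⟨ cong (cycLen (suc m)) (m≤n⇒∣n-m∣≡n∸m c≤m) ⟩
    cycLen (suc m) (suc m ∸ suc c) ≡⟨ cycLen-complement (s≤s c≤m) ⟩
    cycLen (suc m) (suc c)         ∎

cycDist-lipschitz : ∀ {m a b c} → CycleAdjacent m a b ⊎ CycleAdjacent m b a → c < m →
  cycDist m a c ≤ suc (cycDist m b c)
cycDist-lipschitz (inj₁ adj) c<m = proj₁ (cycDist-adjacent adj c<m)
cycDist-lipschitz (inj₂ adj) c<m = proj₂ (cycDist-adjacent adj c<m)

module CycleUpperBound {n} (G : Graph n) (G-sym : Undirected G) {m} (V : ℕ → Fin n)
  (V-next : ∀ t → suc t < m → T (G (V t) (V (suc t))))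
  (V-wrap : ∀ t → suc t ≡ m → T (G (V t) (V 0)))
  (m≤n : m ≤ n) where

  open Walks G

  reach-along : ∀ j k → k + j < m → Reaches k (V j) (V (k + j))
  reach-along j zero    _       = reach-refl 0 (V j)
  reach-along j (suc k) k+j+1<m = reach-step (V-next j (≤-<-trans (s≤s (m≤n+m j k)) k+j+1<m))
    (subst (λ x → Reaches k (V (suc j)) (V x)) (+-suc k j)
           (reach-along (suc j) k (subst (_< m) (sym (+-suc k j)) k+j+1<m)))

  around-the-back : ∀ {j l} → j ≤ l → l < m → (m ∸ suc l) + suc j ≡ m ∸ (l ∸ j)
  around-the-back {j} {l} j≤l l<m = sym (begin
    m ∸ (l ∸ j)                          ≡⟨ cong (_∸ (l ∸ j)) (m∸n+n≡m l<m) ⟨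
    (m ∸ suc l) + suc l ∸ (l ∸ j)        ≡⟨ +-∸-assoc (m ∸ suc l) (m≤n⇒m≤1+n (m∸n≤m l j)) ⟩
    (m ∸ suc l) + (suc l ∸ (l ∸ j))      ≡⟨ cong ((m ∸ suc l) +_) (+-∸-assoc 1 (m∸n≤m l j)) ⟩
    (m ∸ suc l) + suc (l ∸ (l ∸ j))      ≡⟨ cong (λ x → (m ∸ suc l) + suc x) (m∸[m∸n]≡n j≤l) ⟩
    (m ∸ suc l) + suc j                  ∎)
    where open ≡-Reasoning

  dist-ordered≤ : ∀ {j l} → j ≤ l → l < m → dist G (V j) (V l) ≤ cycDist m j l
  dist-ordered≤ {j} {l} j≤l l<m
    rewrite m≤n⇒∣m-n∣≡n∸m j≤l = ⊓-glb forward backward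
    where
    forward : dist G (V j) (V l) ≤ l ∸ j
    forward = dist-≤ (subst (λ x → Reaches (l ∸ j) (V j) (V x)) (m∸n+n≡m j≤l)
                            (reach-along j (l ∸ j) (subst (_< m) (sym (m∸n+n≡m j≤l)) l<m)))
                     (≤-trans (m∸n≤m l j) (≤-trans (<⇒≤ l<m) m≤n))
    last : suc ((m ∸ suc l) + l) ≡ m
    last = trans (sym (+-suc (m ∸ suc l) l)) (m∸n+n≡m l<m)
    to-last : Reaches (m ∸ suc l) (V l) (V ((m ∸ suc l) + l))
    to-last = reach-along l (m ∸ suc l) (subst (_≤ m) (sym last) ≤-refl)
    from-first : Reaches j (V 0) (V j)
    from-first = subst (λ x → Reaches j (V 0) (V x)) (+-identityʳ j)
                       (reach-along 0 j (≤-<-trans (≤-reflexive (+-identityʳ j)) (≤-<-trans j≤l l<m)))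
    the-other-way : Reaches ((m ∸ suc l) + suc j) (V l) (V j)
    the-other-way = reach-trans to-last (reach-step (V-wrap _ last) from-first)
    backward : dist G (V j) (V l) ≤ m ∸ (l ∸ j)
    backward = begin
      dist G (V j) (V l)    ≡⟨ dist-sym G-sym (V j) (V l) ⟩
      dist G (V l) (V j)    ≤⟨ dist-≤ the-other-way (≤-trans (≤-reflexive (around-the-back j≤l l<m))
                                                            (≤-trans (m∸n≤m m (l ∸ j)) m≤n)) ⟩
      (m ∸ suc l) + suc j   ≡⟨ around-the-back j≤l l<m ⟩
      m ∸ (l ∸ j)           ∎
      where open ≤-Reasoning

  dist-cycle≤ : ∀ {j l} → j < m → l < m → dist G (V j) (V l) ≤ cycDist m j l
  dist-cycle≤ {j} {l} j<m l<m with ≤-total j l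
  ... | inj₁ j≤l = dist-ordered≤ j≤l l<m
  ... | inj₂ l≤j = subst₂ _≤_ (dist-sym G-sym (V l) (V j)) (cycDist-comm m l j) (dist-ordered≤ l≤j j<m)

  ∑-dist-cycle≤ : ∀ {j} → j < m → ∑[ l < m ] dist G (V j) (V l) ≤ cycleStatus m
  ∑-dist-cycle≤ {j} j<m = ≤-trans (∑-mono-≤ m (λ l l<m → dist-cycle≤ j<m l<m))
                                  (≤-reflexive (cycDist-row j j<m))

  ∑∑-dist-cycle≤ : ∑∑ m (λ j l → dist G (V j) (V l)) ≤ m * cycleStatus m
  ∑∑-dist-cycle≤ = ≤-trans (∑-mono-≤ m (λ j j<m → ∑-dist-cycle≤ j<m))
                           (≤-reflexive (∑-const m (cycleStatus m)))

-- Upper bounds for G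

-- Vertex x_j has label j − 1, so the
-- chords are 0–2 and (1+q)–(3+q), and labels 1 and 2 + q are the vertices x₂ and x_{i+1}
-- that they bypass.
module CycleWithChords (N q : ℕ) (q≤1+N : q ≤ 1 + N) where

  n : ℕ
  n = 5 + N

  G : Graph n
  G = Gni n (2 + q)

  G-sym : Undirected G
  G-sym = symm-undirected (Gedge n (2 + q))

  Edge : ℕ → ℕ → Set
  Edge a b = T (G (a mod n) (b mod n))

  edge : ∀ a b → a < n → b < n → T (Gedge n (2 + q) a b) → Edge a b
  edge a b a<n b<n e = subst₂ (λ x y → T (symm (Gedge n (2 + q)) x y))
                                  (sym (toℕ-mod a<n)) (sym (toℕ-mod b<n)) (∨-introˡ _ e)

  edge-next : ∀ a → suc a < n → Edge a (suc a)
  edge-next a a+1<n =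
    edge a (suc a) (<-trans (n<1+n a) a+1<n) a+1<n (∨-introˡ _ (≡⇒≡ᵇ (suc a) (suc a) refl))

  edge-wrap : Edge (4 + N) 0
  edge-wrap = edge (4 + N) 0 ≤-refl z<s (∨-introˡ _ (Equivalence.from T-∧ (≡⇒≡ᵇ N N refl , _)))

  edge-0-2 : Edge 0 2
  edge-0-2 = edge 0 2 z<s (s<s (s<s z<s)) _

  edge-chord : Edge (suc q) (3 + q)
  edge-chord = edge (suc q) (3 + q) (<-trans (m<n+m (suc q) {2} z<s) 3+q<n) 3+q<n
    (∨-introʳ (2 + q ≡ᵇ 3 + q) (∨-introʳ ((suc q ≡ᵇ n ∸ 1) ∧ (3 + q ≡ᵇ 0)) (Equivalence.from T-∧
      (≡⇒≡ᵇ (suc q) (suc q) refl , ≡⇒≡ᵇ (3 + q) (2 + q + 1) (cong (2 +_) (+-comm 1 q))))))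
    where
    3+q<n : 3 + q < n
    3+q<n = s<s (s<s (s<s (s≤s q≤1+N)))

  punchIn-edge : ∀ r t → Edge r (2 + r) → suc (suc t) < n →
                 Edge (punchIn (suc r) t) (punchIn (suc r) (suc t))
  punchIn-edge r t chord t+2<n with punchIn-step r t
  ... | inj₁ eq = subst (Edge (punchIn (suc r) t)) (sym eq) (edge-next (punchIn (suc r) t)
    (≤-<-trans (subst (_≤ suc (suc t)) eq (punchIn-≤ (suc r) (suc t))) t+2<n))
  ... | inj₂ (eq₁ , eq₂) = subst₂ Edge (sym eq₁) (sym eq₂) chord

  full-wrap : ∀ t → suc t ≡ n → Edge t 0
  full-wrap t refl = edge-wrap

  module Full = CycleUpperBound G G-sym {n} (_mod n) edge-next full-wrap ≤-refl

  skip-vertex1-next : ∀ t → suc t < 4 + N → Edge (punchIn 1 t) (punchIn 1 (suc t))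
  skip-vertex1-next t t+1<m = punchIn-edge 0 t edge-0-2 (s<s t+1<m)

  skip-vertex1-wrap : ∀ t → suc t ≡ 4 + N → Edge (punchIn 1 t) 0
  skip-vertex1-wrap t refl = edge-wrap

  module SkipVertex1 = CycleUpperBound G G-sym {4 + N} ((_mod n) ∘ punchIn 1)
    skip-vertex1-next skip-vertex1-wrap (n≤1+n _)

  skip-vertexI-next : ∀ t → suc t < 4 + N → Edge (punchIn (2 + q) t) (punchIn (2 + q) (suc t))
  skip-vertexI-next t t+1<m = punchIn-edge (suc q) t edge-chord (s<s t+1<m)

  skip-vertexI-wrap : ∀ t → suc t ≡ 4 + N → Edge (punchIn (2 + q) t) 0
  skip-vertexI-wrap t refl = subst (λ x → Edge x 0) (sym (punchIn-≥ (s≤s (s≤s q≤1+N)))) edge-wrap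

  module SkipVertexI = CycleUpperBound G G-sym {4 + N} ((_mod n) ∘ punchIn (2 + q))
    skip-vertexI-next skip-vertexI-wrap (n≤1+n _)

  δG : ℕ → ℕ → ℕ
  δG = δ G

  ∑∑-remove-vertex1 : ∑∑ n δG ≡ ∑∑ (4 + N) (λ a b → δG (punchIn 1 a) (punchIn 1 b))
                                + 2 * ∑[ b < n ] δG 1 b
  ∑∑-remove-vertex1 = ∑∑-punchIn {4 + N} 1 δG (s≤s z≤n) (λ a → δ-sym G-sym a 1) (δ-self G 1)

  transmission-vertex1≤ : ∑[ b < n ] δG 1 b ≤ cycDist n 1 (2 + q) + cycleStatus (4 + N)
  transmission-vertex1≤ = begin
    ∑[ b < n ] δG 1 b
      ≡⟨ ∑-punchIn (2 + q) (δG 1) (m≤n⇒m≤1+n (s≤s (s≤s q≤1+N))) ⟩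
    δG 1 (2 + q) + ∑[ l < 4 + N ] δG 1 (punchIn (2 + q) l)
      ≤⟨ +-mono-≤ (Full.dist-cycle≤ {1} {2 + q} (s<s z<s) (m≤n⇒m≤1+n (s≤s (s≤s (s≤s q≤1+N)))))
                  (SkipVertexI.∑-dist-cycle≤ (s<s z<s)) ⟩
    cycDist n 1 (2 + q) + cycleStatus (4 + N) ∎
    where open ≤-Reasoning

W-Gni-2≤ : ∀ N → 2 * W (Gni (5 + N) 2) ≤ (4 + N) * cycleStatus (4 + N) + 2 * (1 + cycleStatus (4 + N))
W-Gni-2≤ N = begin
  2 * W G
    ≡⟨ W-as-∑∑ G G-sym ⟩
  ∑∑ n δG
    ≡⟨ ∑∑-remove-vertex1 ⟩
  ∑∑ (4 + N) (λ a b → δG (punchIn 1 a) (punchIn 1 b)) + 2 * ∑[ b < n ] δG 1 b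
    ≤⟨ +-mono-≤ SkipVertex1.∑∑-dist-cycle≤ (*-monoʳ-≤ 2 transmission-vertex1≤) ⟩
  (4 + N) * cycleStatus (4 + N) + 2 * (1 + cycleStatus (4 + N)) ∎
  where
  open ≤-Reasoning
  open CycleWithChords N 0 z≤n

W-Gni-≥3≤ : ∀ N q → q ≤ N →
  2 * W (Gni (5 + N) (3 + q)) ≤ (3 + N) * cycleStatus (3 + N) + 2 * cycleStatus (4 + N)
                                + 2 * (cycDist (5 + N) 1 (3 + q) + cycleStatus (4 + N))
W-Gni-≥3≤ N q q≤N = begin
  2 * W G
    ≡⟨ W-as-∑∑ G G-sym ⟩
  ∑∑ n δG
    ≡⟨ ∑∑-remove-vertex1 ⟩
  ∑∑ (4 + N) δA + 2 * ∑[ b < n ] δG 1 b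
    ≡⟨ cong (_+ 2 * ∑[ b < n ] δG 1 b)
            (∑∑-punchIn {3 + N} (2 + q) δA (s≤s (s≤s q≤1+N))
                        (λ a → δ-sym G-sym (punchIn 1 a) (3 + q)) (δ-self G (3 + q))) ⟩
  ∑∑ (3 + N) (λ a b → δA (punchIn (2 + q) a) (punchIn (2 + q) b)) + 2 * ∑[ b < 4 + N ] δA (2 + q) b
    + 2 * ∑[ b < n ] δG 1 b
    ≤⟨ +-mono-≤ (+-mono-≤ SkipVertices1AndI.∑∑-dist-cycle≤
                          (*-monoʳ-≤ 2 (SkipVertex1.∑-dist-cycle≤ (s<s (s<s (s≤s q≤1+N))))))
                (*-monoʳ-≤ 2 transmission-vertex1≤) ⟩
  (3 + N) * cycleStatus (3 + N) + 2 * cycleStatus (4 + N)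
    + 2 * (cycDist (5 + N) 1 (3 + q) + cycleStatus (4 + N)) ∎
  where
  open ≤-Reasoning
  q≤1+N = m≤n⇒m≤1+n q≤N
  open CycleWithChords N (suc q) (s≤s q≤N)
  δA : ℕ → ℕ → ℕ
  δA a b = δG (punchIn 1 a) (punchIn 1 b)
  skip-both-next : ∀ t → suc t < 3 + N →
    Edge (punchIn 1 (punchIn (2 + q) t)) (punchIn 1 (punchIn (2 + q) (suc t)))
  skip-both-next t t+1<m with punchIn-step (suc q) t
  ... | inj₁ eq = subst (λ x → Edge (punchIn 1 (punchIn (2 + q) t)) (punchIn 1 x)) (sym eq)
    (punchIn-edge 0 (punchIn (2 + q) t) edge-0-2
      (s≤s (≤-<-trans (subst (_≤ suc (suc t)) eq (punchIn-≤ (2 + q) (suc t))) (s<s t+1<m))))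
  ... | inj₂ (eq₁ , eq₂) = subst₂ (λ x y → Edge (punchIn 1 x) (punchIn 1 y)) (sym eq₁) (sym eq₂) edge-chord
  skip-both-wrap : ∀ t → suc t ≡ 3 + N → Edge (punchIn 1 (punchIn (2 + q) t)) 0
  skip-both-wrap t refl = subst (λ x → Edge (punchIn 1 x) 0) (sym (punchIn-≥ (s≤s (s≤s q≤N)))) edge-wrap
  module SkipVertices1AndI = CycleUpperBound G G-sym {3 + N} ((_mod n) ∘ punchIn 1 ∘ punchIn (2 + q))
    skip-both-next skip-both-wrap (≤-trans (n≤1+n _) (n≤1+n _))

-- Lower bound for H_{n,2,2}

module CycleWithTwin (N : ℕ) where

  n m : ℕ
  n = 5 + N
  m = 4 + N

  H : Graph n
  H = H22 n

  H-sym : Undirected H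
  H-sym = symm-undirected (Hedge n)

  open Walks H using (dist-lipschitz; dist->; reach-one)

  -- Deleting vertex 3 leaves the (n−1)-cycle 0, 4, 5, …, n−1, 1, 2; π a is the position of
  -- vertex a on it, the twin 3 getting the position of 2.
  π : ℕ → ℕ
  π 0 = 0
  π 1 = 2 + N
  π 2 = 3 + N
  π 3 = 3 + N
  π (suc (suc (suc (suc c)))) = suc c

  π< : ∀ {a} → a < n → π a < m
  π< {0}                          _ = z<s
  π< {1}                          _ = s<s (s<s (m<n+m N z<s))
  π< {2}                          _ = ≤-refl
  π< {3}                          _ = ≤-refl
  π< {suc (suc (suc (suc c)))} (s<s (s<s (s<s (s<s c<1+N)))) = s<s (≤-trans c<1+N (m≤n+m (suc N) 2))

  Hedge-adjacent : ∀ a b → b < n → T (Hedge n a b) →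
                   CycleAdjacent m (π a) (π b) ⊎ CycleAdjacent m (π b) (π a)
  Hedge-adjacent 0 2 _ _ = inj₂ wrap
  Hedge-adjacent 0 3 _ _ = inj₂ wrap
  Hedge-adjacent 0 4 _ _ = inj₁ (next (s<s z<s))
  Hedge-adjacent 2 1 _ _ = inj₂ (next ≤-refl)
  Hedge-adjacent 3 1 _ _ = inj₂ (next ≤-refl)
  Hedge-adjacent (suc (suc (suc (suc c)))) b b<n e with Equivalence.to T-∨ e
  ... | inj₁ b≡ with refl ← ≡ᵇ⇒≡ (5 + c) b b≡ = inj₁ (next (π< b<n))
  ... | inj₂ e′ with Equivalence.to T-∧ e′
  ...   | c≡N , b≡1 with refl ← ≡ᵇ⇒≡ c N c≡N | refl ← ≡ᵇ⇒≡ b 1 b≡1 =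
    inj₁ (next (s<s (s<s (m<n+m N z<s))))
  Hedge-adjacent 0 0 _ ()
  Hedge-adjacent 0 1 _ ()
  Hedge-adjacent 0 (suc (suc (suc (suc (suc _))))) _ ()
  Hedge-adjacent 1 _ _ ()
  Hedge-adjacent 2 0 _ ()
  Hedge-adjacent 2 (suc (suc _)) _ ()
  Hedge-adjacent 3 0 _ ()
  Hedge-adjacent 3 (suc (suc _)) _ ()

  δH : ℕ → ℕ → ℕ
  δH = δ H

  cycDist≤δH : ∀ {a b} → a < n → b < n → cycDist m (π a) (π b) ≤ δH a b
  cycDist≤δH {a} {b} a<n b<n = subst₂ _≤_ (cong (λ x → cycDist m (π x) (π b)) (toℕ-mod a<n)) f-v≡0
    (dist-lipschitz f f-edge {a mod n} {b mod n}
      (≤-trans (cycDist≤ m (π (toℕ (a mod n))) (π b)) (≤-trans (n≤1+n m) (m≤m+n n _))))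
    where
    f : Fin n → ℕ
    f x = cycDist m (π (toℕ x)) (π b)
    f-edge : ∀ x w → T (H x w) → f x ≤ suc (f w)
    f-edge x w e with Equivalence.to T-∨ e
    ... | inj₁ e′ = cycDist-lipschitz (Hedge-adjacent (toℕ x) (toℕ w) (toℕ<n w) e′) (π< b<n)
    ... | inj₂ e′ = cycDist-lipschitz (swap (Hedge-adjacent (toℕ w) (toℕ x) (toℕ<n x) e′)) (π< b<n)
    f-v≡0 : δH a b + f (b mod n) ≡ δH a b
    f-v≡0 = trans (cong (δH a b +_) (trans (cong (λ x → cycDist m (π x) (π b)) (toℕ-mod b<n))
                                            (cycDist-self m (π b))))
                  (+-identityʳ _)

  twins-apart : 2 ≤ δH 3 2
  twins-apart = dist-> {1} {3 mod n} {2 mod n} (s<s z<s) (λ r → [ (λ ()) , (λ ()) ] (reach-one r))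

  ∑-π∘punchIn₃ : ∀ (F : ℕ → ℕ) → ∑[ b < m ] F (π (punchIn 3 b)) ≡ ∑[ t < m ] F t
  ∑-π∘punchIn₃ F = begin
    F 0 + (F (2 + N) + (F (3 + N) + ∑[ c < suc N ] F (suc c)))
      ≡⟨ rotate (F 0) (F (2 + N)) (F (3 + N)) _ ⟩
    F 0 + (∑[ c < suc N ] F (suc c) + F (2 + N) + F (3 + N))
      ≡⟨ cong (λ x → F 0 + (x + F (3 + N))) (∑-init-last (suc N) (F ∘ suc)) ⟨
    F 0 + (∑[ c < 2 + N ] F (suc c) + F (3 + N))
      ≡⟨ cong (F 0 +_) (∑-init-last (2 + N) (F ∘ suc)) ⟨
    ∑[ t < m ] F t ∎
    where
    open ≡-Reasoning
    rotate : ∀ x y z s → x + (y + (z + s)) ≡ x + (s + y + z)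
    rotate = solve-∀

  π∘punchIn₂≗π∘punchIn₃ : ∀ l → π (punchIn 2 l) ≡ π (punchIn 3 l)
  π∘punchIn₂≗π∘punchIn₃ 0                     = refl
  π∘punchIn₂≗π∘punchIn₃ 1                     = refl
  π∘punchIn₂≗π∘punchIn₃ 2                     = refl
  π∘punchIn₂≗π∘punchIn₃ (suc (suc (suc _))) = refl

  ∑-cycDist≤δH : ∀ p {x} → x < n → (∀ l → π (punchIn p l) ≡ π (punchIn 3 l)) →
    cycleStatus m ≤ ∑[ b < m ] δH x (punchIn p b)
  ∑-cycDist≤δH p {x} x<n π-eq = begin
    cycleStatus m                                ≡⟨ cycDist-row (π x) (π< x<n) ⟨
    ∑[ t < m ] cycDist m (π x) t                 ≡⟨ ∑-π∘punchIn₃ (cycDist m (π x)) ⟨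
    ∑[ b < m ] cycDist m (π x) (π (punchIn 3 b)) ≡⟨ ∑-cong m (λ b _ → cong (cycDist m (π x)) (π-eq b)) ⟨
    ∑[ b < m ] cycDist m (π x) (π (punchIn p b))
      ≤⟨ ∑-mono-≤ m (λ b b<m → cycDist≤δH x<n (punchIn<n b<m)) ⟩
    ∑[ b < m ] δH x (punchIn p b)                ∎
    where
    open ≤-Reasoning
    punchIn<n : ∀ {b} → b < m → punchIn p b < n
    punchIn<n {b} b<m = s≤s (≤-trans (punchIn-≤ p b) b<m)

W-H22≥ : ∀ N → (4 + N) * cycleStatus (4 + N) + 2 * (2 + cycleStatus (4 + N)) ≤ 2 * W (H22 (5 + N))
W-H22≥ N = begin
  m * cycleStatus m + 2 * (2 + cycleStatus m)
    ≤⟨ +-mono-≤ cycle-part (*-monoʳ-≤ 2 twin-row) ⟩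
  ∑∑ m (λ a b → δH (punchIn 3 a) (punchIn 3 b)) + 2 * ∑[ b < n ] δH 3 b
    ≡⟨ ∑∑-punchIn {m} 3 δH (s≤s (s≤s (s≤s z≤n))) (λ a → δ-sym H-sym a 3) (δ-self H 3) ⟨
  ∑∑ n δH
    ≡⟨ W-as-∑∑ H H-sym ⟨
  2 * W H ∎
  where
  open ≤-Reasoning
  open CycleWithTwin N
  cycle-part : m * cycleStatus m ≤ ∑∑ m (λ a b → δH (punchIn 3 a) (punchIn 3 b))
  cycle-part = ≤-trans (≤-reflexive (sym (∑-const m (cycleStatus m))))
    (∑-mono-≤ m (λ a a<m → ∑-cycDist≤δH 3 (s≤s (≤-trans (punchIn-≤ 3 a) a<m)) (λ _ → refl)))
  twin-row : 2 + cycleStatus m ≤ ∑[ b < n ] δH 3 b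
  twin-row = begin
    2 + cycleStatus m
      ≤⟨ +-mono-≤ twins-apart
                  (∑-cycDist≤δH 2 (s≤s (s≤s (s≤s (s≤s z≤n)))) π∘punchIn₂≗π∘punchIn₃) ⟩
    δH 3 2 + ∑[ l < m ] δH 3 (punchIn 2 l)
      ≡⟨ ∑-punchIn {m} 2 (δH 3) (s≤s (s≤s z≤n)) ⟨
    ∑[ b < n ] δH 3 b ∎

even-or-odd : ∀ N → Σ ℕ (λ r → N ≡ r + r ⊎ N ≡ suc (r + r))
even-or-odd zero    = 0 , inj₁ refl
even-or-odd (suc N) with even-or-odd N
... | r , inj₁ refl = r , inj₂ refl
... | r , inj₂ refl = suc r , inj₁ (cong suc (sym (+-suc r r)))

status-gap-even : ∀ r → let N = r + r in
  (3 + N) * cycleStatus (3 + N) + (5 + N) < (2 + N) * cycleStatus (4 + N) + 4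
status-gap-even r = begin-strict
  (3 + (r + r)) * cycleStatus (3 + (r + r)) + (5 + (r + r))
    ≡⟨ cong (λ c → (3 + (r + r)) * c + (5 + (r + r)))
            (trans (cong cycleStatus (odd-index r)) (cycleStatus-odd (suc r))) ⟩
  (3 + (r + r)) * (suc r * suc r + suc r) + (5 + (r + r))
    <⟨ s≤s (m≤m+n _ (r * r + r)) ⟩
  suc ((3 + (r + r)) * (suc r * suc r + suc r) + (5 + (r + r)) + (r * r + r))
    ≡⟨ slack r ⟩
  (2 + (r + r)) * ((2 + r) * (2 + r)) + 4
    ≡⟨ cong (λ c → (2 + (r + r)) * c + 4)
            (trans (cong cycleStatus (even-index r)) (cycleStatus-even (2 + r))) ⟨
  (2 + (r + r)) * cycleStatus (4 + (r + r)) + 4 ∎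
  where
  open ≤-Reasoning
  odd-index : ∀ r → 3 + (r + r) ≡ suc (suc r + suc r)
  odd-index = solve-∀
  even-index : ∀ r → 4 + (r + r) ≡ (2 + r) + (2 + r)
  even-index = solve-∀
  slack : ∀ r → suc ((3 + (r + r)) * (suc r * suc r + suc r) + (5 + (r + r)) + (r * r + r))
                ≡ (2 + (r + r)) * ((2 + r) * (2 + r)) + 4
  slack = solve-∀

status-gap-odd : ∀ r → let N = suc (suc r + suc r) in
  (3 + N) * cycleStatus (3 + N) + (5 + N) < (2 + N) * cycleStatus (4 + N) + 4
status-gap-odd r = begin-strict
  (3 + N) * cycleStatus (3 + N) + (5 + N)
    ≡⟨ cong (λ c → (3 + N) * c + (5 + N))
            (trans (cong cycleStatus (even-index r)) (cycleStatus-even (3 + r))) ⟩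
  (3 + N) * ((3 + r) * (3 + r)) + (5 + N)
    <⟨ m<m+n _ z<s ⟩
  (3 + N) * ((3 + r) * (3 + r)) + (5 + N) + (suc r * suc r + suc r)
    ≡⟨ slack r ⟩
  (2 + N) * ((3 + r) * (3 + r) + (3 + r)) + 4
    ≡⟨ cong (λ c → (2 + N) * c + 4)
            (trans (cong cycleStatus (odd-index r)) (cycleStatus-odd (3 + r))) ⟨
  (2 + N) * cycleStatus (4 + N) + 4 ∎
  where
  open ≤-Reasoning
  N = suc (suc r + suc r)
  even-index : ∀ r → 3 + suc (suc r + suc r) ≡ (3 + r) + (3 + r)
  even-index = solve-∀
  odd-index : ∀ r → 4 + suc (suc r + suc r) ≡ suc ((3 + r) + (3 + r))
  odd-index = solve-∀
  slack : ∀ r → let N = suc (suc r + suc r) in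
    (3 + N) * ((3 + r) * (3 + r)) + (5 + N) + (suc r * suc r + suc r)
    ≡ (2 + N) * ((3 + r) * (3 + r) + (3 + r)) + 4
  slack = solve-∀

status-gap : ∀ N → N ≢ 1 →
  (3 + N) * cycleStatus (3 + N) + (5 + N) < (2 + N) * cycleStatus (4 + N) + 4
status-gap N N≢1 with even-or-odd N
... | r     , inj₁ refl = status-gap-even r
... | zero  , inj₂ refl = ⊥-elim (N≢1 refl)
... | suc r , inj₂ refl = status-gap-odd r

W-Gni-2<W-H22 : ∀ N → W (Gni (5 + N) 2) < W (H22 (5 + N))
W-Gni-2<W-H22 N = *-cancelˡ-< 2 _ _ (begin-strict
  2 * W (Gni (5 + N) 2)                                          ≤⟨ W-Gni-2≤ N ⟩
  (4 + N) * cycleStatus (4 + N) + 2 * (1 + cycleStatus (4 + N))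
    <⟨ +-monoʳ-< ((4 + N) * cycleStatus (4 + N)) (*-monoʳ-< 2 (n<1+n (1 + cycleStatus (4 + N)))) ⟩
  (4 + N) * cycleStatus (4 + N) + 2 * (2 + cycleStatus (4 + N))  ≤⟨ W-H22≥ N ⟩
  2 * W (H22 (5 + N))                                            ∎)
  where open ≤-Reasoning

W-Gni-≥3<W-H22 : ∀ N q → q ≤ N → N ≢ 1 → W (Gni (5 + N) (3 + q)) < W (H22 (5 + N))
W-Gni-≥3<W-H22 N q q≤N N≢1 = *-cancelˡ-< 2 _ _ (begin-strict
  2 * W (Gni (5 + N) (3 + q))
    ≤⟨ W-Gni-≥3≤ N q q≤N ⟩
  (3 + N) * c₃ + 2 * c₄ + 2 * (d + c₄)
    ≡⟨ cong ((3 + N) * c₃ + 2 * c₄ +_) (*-distribˡ-+ 2 d c₄) ⟩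
  (3 + N) * c₃ + 2 * c₄ + (2 * d + 2 * c₄)
    ≤⟨ +-monoʳ-≤ ((3 + N) * c₃ + 2 * c₄) (+-monoˡ-≤ (2 * c₄) (2*cycDist≤ (s≤s z≤n) 3+q≤n)) ⟩
  (3 + N) * c₃ + 2 * c₄ + ((5 + N) + 2 * c₄)
    ≡⟨ regroup ((3 + N) * c₃) c₄ (5 + N) ⟩
  ((3 + N) * c₃ + (5 + N)) + 4 * c₄
    <⟨ +-monoˡ-< (4 * c₄) (status-gap N N≢1) ⟩
  ((2 + N) * c₄ + 4) + 4 * c₄
    ≡⟨ collect N c₄ ⟩
  (4 + N) * c₄ + 2 * (2 + c₄)
    ≤⟨ W-H22≥ N ⟩
  2 * W (H22 (5 + N)) ∎)
  where
  open ≤-Reasoning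
  c₃ = cycleStatus (3 + N)
  c₄ = cycleStatus (4 + N)
  d  = cycDist (5 + N) 1 (3 + q)
  3+q≤n : 3 + q ≤ 5 + N
  3+q≤n = +-monoʳ-≤ 3 (≤-trans q≤N (m≤n+m N 2))
  regroup : ∀ x c k → x + 2 * c + (k + 2 * c) ≡ x + k + 4 * c
  regroup = solve-∀
  collect : ∀ N c → (2 + N) * c + 4 + 4 * c ≡ (4 + N) * c + 2 * (2 + c)
  collect = solve-∀

-- For n = 6 the estimates above only give W(G) ≤ W(H), so this case is computed.
W-Gni-6-3<W-H22 : W (Gni 6 3) < W (H22 6)
W-Gni-6-3<W-H22 = <ᵇ⇒< (W (Gni 6 3)) (W (H22 6)) tt

W-Gni<W-H22 : ∀ N i → 1 < i → i ≤ 3 + N → ¬ (5 + N ≡ 6 × i ≡ 4) → W (Gni (5 + N) i) < W (H22 (5 + N))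
W-Gni<W-H22 N             2                   _ _                         _   = W-Gni-2<W-H22 N
W-Gni<W-H22 0             (suc (suc (suc q))) _ (s≤s (s≤s (s≤s q≤0)))   _   = W-Gni-≥3<W-H22 0 q q≤0 (λ ())
W-Gni<W-H22 (suc (suc N)) (suc (suc (suc q))) _ (s≤s (s≤s (s≤s q≤2+N))) _ =
  W-Gni-≥3<W-H22 (2 + N) q q≤2+N (λ ())
W-Gni<W-H22 1             3                   _ _                         _   = W-Gni-6-3<W-H22
W-Gni<W-H22 1             4                   _ _                         exc = ⊥-elim (exc (refl , refl))
W-Gni<W-H22 1             (suc (suc (suc (suc (suc _))))) _ (s≤s (s≤s (s≤s (s≤s ())))) _
W-Gni<W-H22 _             0                   ()       _ _
W-Gni<W-H22 _             1                   (s≤s ()) _ _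

proposition6 : (n i : ℕ) → 5 ≤ n → 1 < i → i ≤ n ∸ 2 →
    (¬ (n ≡ 6 × i ≡ 4) → W (Gni n i) < W (H22 n)) ×
    ((n ≡ 6 × i ≡ 4) → W (Gni n i) ≡ W (H22 n))
proposition6 _ i (s≤s (s≤s (s≤s (s≤s (s≤s {n = N} z≤n))))) 1<i i≤3+N =
  W-Gni<W-H22 N i 1<i i≤3+N , exceptional
  where
  exceptional : 5 + N ≡ 6 × i ≡ 4 → W (Gni (5 + N) i) ≡ W (H22 (5 + N))
  exceptional (refl , refl) = refl
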